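{- Let $G$ be an infinite abelian group, $A\subset G$ and $h$ a positive integer. (i) If $hA\sim G$, then $(h+1)A=G$. (ii) If $\bigcup_{i=1}^h iA\sim G$, then $\bigcup_{i=2}^{h+1} iA=G$.
   Context: $iA$ is the set of sums of $i$ not necessarily distinct elements of $A$; $X\sim Y$ means the symmetric difference of $X$ and $Y$ is finite. -}

module Defs where

open import Level using (0ℓ)
open import Algebra.Bundles using (AbelianGroup)
open import Data.Nat using (ℕ; zero; suc; _≤_)
open import Data.Fin using (Fin; zero; suc)
open import Data.List using (List)
open import Data.List.Relation.Unary.Any using (Any)
open import Data.Product using (Σ; _×_)
open import Data.Sum using (_⊎_)
open import Data.Unit using (⊤)
open import Relation.Nullary using (¬_)

module Sumset (G : AbelianGroup 0ℓ 0ℓ) where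
  open AbelianGroup G

  Subset : Set₁
  Subset = Carrier → Set

  Respects≈ : Subset → Set
  Respects≈ A = ∀ {x y} → x ≈ y → A x → A y

  Univ : Subset
  Univ _ = ⊤

  Σsum : ∀ {n} → (Fin n → Carrier) → Carrier
  Σsum {zero}  v = ε
  Σsum {suc n} v = v zero ∙ Σsum (λ j → v (suc j))

  -- iA : sums of i not necessarily distinct elements of A
  _·_ : ℕ → Subset → Subset
  (i · A) x = Σ (Fin i → Carrier) λ v → (∀ j → A (v j)) × (Σsum v ≈ x)

  ⋃[_,_]_ : ℕ → ℕ → Subset → Subset
  (⋃[ a , b ] A) x = Σ ℕ λ i → (a ≤ i) × (i ≤ b) × (i · A) x

  Finite : Subset → Set
  Finite X = Σ (List Carrier) λ L → ∀ x → X x → Any (x ≈_) L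

  Infinite : Set
  Infinite = ¬ Finite Univ

  _∼_ : Subset → Subset → Set
  X ∼ Y = Finite (λ x → (X x × ¬ Y x) ⊎ (Y x × ¬ X x))

  _≐_ : Subset → Subset → Set
  X ≐ Y = ∀ x → (X x → Y x) × (Y x → X x)

module Submission where

-- Let G be infinite, Y ⊆ G cofinite, and suppose Y is finite whenever
-- A is.  Then every x ∈ G lies in A + Y: otherwise x - a ∉ Y for every a ∈ A,
-- so A lies in the translate x - (G ∖ Y) of a finite set and is finite; hence
-- Y is finite, and G = Y ∪ (G ∖ Y) would be finite.  Both parts of the lemma
-- are instances: for (i) take Y = hA, for (ii) take Y = ⋃_{1≤i≤h} iA; in
-- either case Y is finite when A is, and A + Y lies in (h+1)A, respectively
-- in ⋃_{2≤i≤h+1} iA.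

open import Defs
open import Level using (0ℓ)
open import Algebra.Bundles using (AbelianGroup)
open import Axiom.ExcludedMiddle using (ExcludedMiddle)
open import Axiom.DoubleNegationElimination using (em⇒dne)
open import Data.Nat using (ℕ; zero; suc; _≤_; s≤s)
open import Data.Fin using (Fin; zero; suc)
open import Data.List using (List; []; _∷_; _++_; map; concat; applyUpTo; cartesianProductWith)
open import Data.List.Relation.Unary.Any using (Any; here)
import Data.List.Relation.Unary.Any as Any
open import Data.List.Relation.Unary.Any.Properties
  using (++⁺ˡ; ++⁺ʳ; map⁺; concat⁺; applyUpTo⁺; cartesianProductWith⁺)
open import Data.Product using (Σ; _×_; _,_; proj₁; proj₂)
open import Data.Sum using (_⊎_; inj₁; inj₂)
open import Data.Unit using (tt)
open import Relation.Nullary using (¬_; yes; no)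
import Algebra.Properties.Group as GroupProperties
import Relation.Binary.Reasoning.Setoid as SetoidReasoning

module SumsetFacts (G : AbelianGroup 0ℓ 0ℓ) where
  open AbelianGroup G
  open Sumset G
  open GroupProperties group using (\\-leftDividesˡ; ⁻¹-anti-homo-\\)

  infix 4 _⊆_
  infixl 6 _⊕_ _∪_ _Δ_

  _⊆_ : Subset → Subset → Set
  X ⊆ Y = ∀ x → X x → Y x

  _∪_ : Subset → Subset → Subset
  (X ∪ Y) x = X x ⊎ Y x

  _Δ_ : Subset → Subset → Subset
  (X Δ Y) x = (X x × ¬ Y x) ⊎ (Y x × ¬ X x)

  _⊕_ : Subset → Subset → Subset
  (X ⊕ Y) z = Σ Carrier λ x → Σ Carrier λ y → X x × Y y × (x ∙ y ≈ z)

  ⊇Univ⇒≐Univ : ∀ {X} → Univ ⊆ X → X ≐ Univ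
  ⊇Univ⇒≐Univ covers x = (λ _ → tt) , covers x

  suc·⊆⊕ : ∀ A i → suc i · A ⊆ A ⊕ (i · A)
  suc·⊆⊕ A i x (v , v∈A , Σv≈x) =
    v zero , Σsum tail , v∈A zero , (tail , (λ j → v∈A (suc j)) , refl) , Σv≈x
    where
      tail : Fin i → Carrier
      tail j = v (suc j)

  ⊕⊆suc· : ∀ A i → A ⊕ (i · A) ⊆ suc i · A
  ⊕⊆suc· A i x (a , y , a∈A , (v , v∈A , Σv≈y) , a∙y≈x) =
    cons , cons∈A , trans (∙-congˡ Σv≈y) a∙y≈x
    where
      cons : Fin (suc i) → Carrier
      cons zero    = a
      cons (suc j) = v j
      cons∈A : ∀ j → A (cons j)
      cons∈A zero    = a∈A
      cons∈A (suc j) = v∈A j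

  ⊕⋃⊆⋃ : ∀ A a b → A ⊕ (⋃[ a , b ] A) ⊆ ⋃[ suc a , suc b ] A
  ⊕⋃⊆⋃ A a b x (c , y , c∈A , (i , a≤i , i≤b , y∈iA) , c∙y≈x) =
    suc i , s≤s a≤i , s≤s i≤b , ⊕⊆suc· A i x (c , y , c∈A , y∈iA , c∙y≈x)

  finite-⊆ : ∀ {X Y} → X ⊆ Y → Finite Y → Finite X
  finite-⊆ X⊆Y (L , Y⊆L) = L , λ x x∈X → Y⊆L x (X⊆Y x x∈X)

  finite-∪ : ∀ {X Y} → Finite X → Finite Y → Finite (X ∪ Y)
  finite-∪ (L , X⊆L) (M , Y⊆M) = L ++ M , λ
    { x (inj₁ x∈X) → ++⁺ˡ (X⊆L x x∈X)
    ; x (inj₂ x∈Y) → ++⁺ʳ L (Y⊆M x x∈Y) }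

  finite-⋃≤ : (F : ℕ → Subset) → (∀ i → Finite (F i)) → ∀ b →
              Finite (λ x → Σ ℕ λ i → i ≤ b × F i x)
  finite-⋃≤ F finF b = concat (applyUpTo list (suc b)) , λ
    { x (i , i≤b , x∈Fi) → concat⁺ (applyUpTo⁺ list (proj₂ (finF i) x x∈Fi) (s≤s i≤b)) }
    where
      list : ℕ → List Carrier
      list i = proj₁ (finF i)

  finite-⊕ : ∀ {X Y} → Finite X → Finite Y → Finite (X ⊕ Y)
  finite-⊕ (L , X⊆L) (M , Y⊆M) = cartesianProductWith _∙_ L M , λ
    { z (x , y , x∈X , y∈Y , x∙y≈z) →
        Any.map (trans (sym x∙y≈z))
          (cartesianProductWith⁺ _∙_ ∙-cong (X⊆L x x∈X) (Y⊆M y y∈Y)) }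

  finite-· : ∀ {A} i → Finite A → Finite (i · A)
  finite-· zero    finA = ε ∷ [] , λ { x (_ , _ , ε≈x) → here (sym ε≈x) }
  finite-· (suc i) finA = finite-⊆ (suc·⊆⊕ _ i) (finite-⊕ finA (finite-· i finA))

  finite-⋃ : ∀ {A} a b → Finite A → Finite (⋃[ a , b ] A)
  finite-⋃ {A} a b finA = finite-⊆ drop-lower-bound (finite-⋃≤ (_· A) (λ i → finite-· i finA) b)
    where
      drop-lower-bound : ⋃[ a , b ] A ⊆ (λ x → Σ ℕ λ i → i ≤ b × (i · A) x)
      drop-lower-bound x (i , _ , i≤b , x∈iA) = i , i≤b , x∈iA

  finite-preimage : ∀ {X} (f g : Carrier → Carrier) → (∀ {x y} → x ≈ y → g x ≈ g y) →
                    (∀ a → g (f a) ≈ a) → Finite X → Finite (λ a → X (f a))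
  finite-preimage f g g-cong g∘f≈id (L , X⊆L) = map g L , λ a fa∈X →
    map⁺ (Any.map (λ fa≈l → trans (sym (g∘f≈id a)) (g-cong fa≈l)) (X⊆L (f a) fa∈X))

  translate-inverse : ∀ x a → x ∙ (a ⁻¹ ∙ x) ⁻¹ ≈ a
  translate-inverse x a = begin
    x ∙ (a ⁻¹ ∙ x) ⁻¹  ≈⟨ ∙-congˡ (⁻¹-anti-homo-\\ a x) ⟩
    x ∙ (x ⁻¹ ∙ a)     ≈⟨ \\-leftDividesˡ x a ⟩
    a                  ∎
    where open SetoidReasoning setoid

module CofiniteSumset (em : ExcludedMiddle 0ℓ) (G : AbelianGroup 0ℓ 0ℓ) where
  open AbelianGroup G
  open Sumset G
  open SumsetFacts G
  open GroupProperties group using (\\-leftDividesˡ)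

  finite-cofinite⇒finite-group : ∀ {Y} → Y ∼ Univ → Finite Y → Finite Univ
  finite-cofinite⇒finite-group {Y} Y∼Univ finY =
    finite-⊆ Univ⊆Y∪∁Y (finite-∪ finY (finite-⊆ ∁Y⊆YΔUniv Y∼Univ))
    where
      Univ⊆Y∪∁Y : Univ ⊆ Y ∪ (λ x → ¬ Y x)
      Univ⊆Y∪∁Y x _ with em {Y x}
      ... | yes x∈Y = inj₁ x∈Y
      ... | no  x∉Y = inj₂ x∉Y
      ∁Y⊆YΔUniv : (λ x → ¬ Y x) ⊆ Y Δ Univ
      ∁Y⊆YΔUniv x x∉Y = inj₂ (tt , x∉Y)

  -- If x ∉ A + Y then a ↦ a⁻¹ ∙ x maps A
  -- into the finite set G ∖ Y, so A, hence Y, hence G would be finite.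
  cofinite-sumset-covers : ∀ {A Y} → Infinite → Y ∼ Univ → (Finite A → Finite Y) →
                           Univ ⊆ A ⊕ Y
  cofinite-sumset-covers {A} {Y} infinite Y∼Univ finA⇒finY x _ = em⇒dne em ¬¬x∈A⊕Y
    where
      translate : Carrier → Carrier
      translate a = a ⁻¹ ∙ x
      ¬¬x∈A⊕Y : ¬ ¬ (A ⊕ Y) x
      ¬¬x∈A⊕Y x∉A⊕Y = infinite (finite-cofinite⇒finite-group Y∼Univ (finA⇒finY finA))
        where
          A⊆translate⁻¹YΔUniv : A ⊆ (λ a → (Y Δ Univ) (translate a))
          A⊆translate⁻¹YΔUniv a a∈A = inj₂ (tt , λ y∈Y →
            x∉A⊕Y (a , translate a , a∈A , y∈Y , \\-leftDividesˡ a x))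
          finA : Finite A
          finA = finite-⊆ A⊆translate⁻¹YΔUniv
                   (finite-preimage translate (λ l → x ∙ l ⁻¹) (λ e → ∙-congˡ (⁻¹-cong e))
                     (translate-inverse x) Y∼Univ)

lemma2p5 : ExcludedMiddle 0ℓ →
    (G : AbelianGroup 0ℓ 0ℓ) → let open Sumset G in
    Infinite → (A : Subset) → Respects≈ A → (h : ℕ) → 1 ≤ h →
    ((h · A) ∼ Univ → (suc h · A) ≐ Univ)
    × ((⋃[ 1 , h ] A) ∼ Univ → (⋃[ 2 , suc h ] A) ≐ Univ)
lemma2p5 em G infinite A _ h _ = part-i , part-ii
  where
    open Sumset G
    open SumsetFacts G
    open CofiniteSumset em G

    part-i : (h · A) ∼ Univ → (suc h · A) ≐ Univ
    part-i hA∼Univ = ⊇Univ⇒≐Univ λ x _ →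
      ⊕⊆suc· A h x (cofinite-sumset-covers infinite hA∼Univ (finite-· h) x tt)

    part-ii : (⋃[ 1 , h ] A) ∼ Univ → (⋃[ 2 , suc h ] A) ≐ Univ
    part-ii ⋃A∼Univ = ⊇Univ⇒≐Univ λ x _ →
      ⊕⋃⊆⋃ A 1 h x (cofinite-sumset-covers infinite ⋃A∼Univ (finite-⋃ 1 h) x tt)
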